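{- Let $b\ge2$ and let $P,Q$ be positive coprime integers that are both coprime to $b$, with $b<P<Q$. Let $D$ be the directed graph with vertex set $\{(i,j): 0\le i\le P-1,\ 0\le j\le Q-1\}$ and with an edge $(i,j)\to\left(\left\lfloor \frac{i+rP}{b}\right\rfloor,\left\lfloor \frac{j+rQ}{b}\right\rfloor\right)$ for every vertex $(i,j)$ and every $r\in\{0,\ldots,b-1\}$, and let $\mathcal{C}$ be the strongly connected component of $D$ containing $(0,0)$. Then there exists an integer $0\le i_0<b$ such that $\{(i_0,b-1),(i_0,b)\}\subseteq\mathcal{C}$. -}

module Defs where

open import Data.Nat using (ℕ; _+_; _*_; _<_; NonZero)
open import Data.Nat.DivMod using (_/_)
open import Data.Product using (_×_; _,_; ∃-syntax)
open import Relation.Binary.PropositionalEquality using (_≡_)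
open import Relation.Binary.Construct.Closure.ReflexiveTransitive using (Star)

Vertex : ℕ → ℕ → ℕ × ℕ → Set
Vertex P Q (i , j) = i < P × j < Q

Edge : (b P Q : ℕ) → .{{NonZero b}} → ℕ × ℕ → ℕ × ℕ → Set
Edge b P Q (i , j) (i' , j') =
  Vertex P Q (i , j) ×
  (∃[ r ] (r < b × i' ≡ (i + r * P) / b × j' ≡ (j + r * Q) / b))

Reach : (b P Q : ℕ) → .{{NonZero b}} → ℕ × ℕ → ℕ × ℕ → Set
Reach b P Q = Star (Edge b P Q)

InSCC₀ : (b P Q : ℕ) → .{{NonZero b}} → ℕ × ℕ → Set
InSCC₀ b P Q v =
  Vertex P Q v × Reach b P Q (0 , 0) v × Reach b P Q v (0 , 0)

{-# OPTIONS --safe #-}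
module Submission where

-- From (0 , 0), the edge labelled r prepends r as a new leading base-b digit of N, so every
-- (⌊PN/b^k⌋ , ⌊QN/b^k⌋) with N < b^k is reachable; the edges labelled 0 divide both coordinates
-- by b and lead back to (0 , 0), so all these vertices lie in the component of (0 , 0).
-- Take M = b^k > PQ and N = ⌊bM/Q⌋. Since Q ∤ bM, the multiples QN and Q(N+1) straddle bM, which
-- gives the second coordinates b - 1 and b. Since Q ∤ Pb, the fraction Pb/Q = i₀ + e/Q has e ≥ 1,
-- and PN/M, P(N+1)/M differ from it by less than 1/Q in the appropriate directions, so both have
-- floor i₀ = ⌊Pb/Q⌋ < b.

open import Defs
open import Data.Nat
open import Data.Nat.Properties
open import Data.Nat.DivMod
open import Data.Nat.Divisibility using (_∣_; divides; ∣⇒≤; ∣1⇒≡1; m%n≡0⇒n∣m)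
open import Data.Nat.Coprimality using (Coprime; coprime-divisor)
import Data.Nat.Coprimality as Coprimality
open import Data.Product using (_×_; _,_; ∃-syntax)
open import Data.List using (_∷_; [])
open import Data.Nat.Tactic.RingSolver using (solve)
open import Relation.Binary.PropositionalEquality
open import Relation.Binary.Construct.Closure.ReflexiveTransitive using (ε; _◅_; _◅◅_)

quotient-unique : ∀ {m n k} .{{_ : NonZero n}} → k * n ≤ m → m < suc k * n → m / n ≡ k
quotient-unique {m} {n} {k} k*n≤m m<[1+k]*n = ≤-antisym
  (≤-pred (m<n*o⇒m/o<n m<[1+k]*n))
  (subst (_≤ m / n) (m*n/n≡m k n) (/-monoˡ-≤ n k*n≤m))

[m/n+o]/p≡[m+o*n]/[n*p] : ∀ m n o p .{{_ : NonZero n}} .{{_ : NonZero p}} .{{_ : NonZero (n * p)}} →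
                          (m / n + o) / p ≡ (m + o * n) / (n * p)
[m/n+o]/p≡[m+o*n]/[n*p] m n o p = begin
  (m / n + o) / p           ≡⟨ /-congˡ {o = p} (cong (m / n +_) (sym (m*n/n≡m o n))) ⟩
  (m / n + o * n / n) / p   ≡⟨ /-congˡ {o = p} (sym (+-distrib-/-∣ʳ m (divides o refl))) ⟩
  (m + o * n) / n / p       ≡⟨ m/n/o≡m/[n*o] (m + o * n) n p ⟩
  (m + o * n) / (n * p)     ∎
  where open ≡-Reasoning

n<b^n : ∀ b n .{{_ : NonZero b}} → 1 < b → n < b ^ n
n<b^n b zero    _   = s≤s z≤n
n<b^n b (suc n) 1<b = begin-strict
  suc n      ≤⟨ n<b^n b n 1<b ⟩
  b ^ n      <⟨ m<m*n (b ^ n) b 1<b ⟩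
  b ^ n * b  ≡⟨ *-comm (b ^ n) b ⟩
  b * b ^ n  ∎
  where
  open ≤-Reasoning
  instance
    b^n≢0 : NonZero (b ^ n)
    b^n≢0 = m^n≢0 b n

coprime-∣^⇒∣1 : ∀ {m n} k → Coprime m n → m ∣ n ^ k → m ∣ 1
coprime-∣^⇒∣1 zero    _   m∣1     = m∣1
coprime-∣^⇒∣1 (suc k) m⊥n m∣n^1+k = coprime-∣^⇒∣1 k m⊥n (coprime-divisor m⊥n m∣n^1+k)

m*n/o<m : ∀ m {n o} .{{_ : NonZero m}} .{{_ : NonZero o}} → n < o → m * n / o < m
m*n/o<m m n<o = m<n*o⇒m/o<n (*-monoʳ-< m n<o)

m*n/o<n : ∀ {m} n {o} .{{_ : NonZero n}} .{{_ : NonZero o}} → m < o → m * n / o < n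
m*n/o<n {m} n {o} m<o = subst (_< n) (/-congˡ {o = o} (*-comm n m)) (m*n/o<m n m<o)

coprime⇒m^n%o>0 : ∀ m n {o} .{{_ : NonZero o}} → Coprime o m → 1 < o → m ^ n % o > 0
coprime⇒m^n%o>0 m n {o} o⊥m 1<o = n≢0⇒n>0 λ m^n%o≡0 →
  >⇒≢ 1<o (∣1⇒≡1 (coprime-∣^⇒∣1 n o⊥m (m%n≡0⇒n∣m (m ^ n) o m^n%o≡0)))

coprime⇒m*n%o>0 : ∀ m n {o} .{{_ : NonZero n}} .{{_ : NonZero o}} → Coprime o m → n < o → m * n % o > 0
coprime⇒m*n%o>0 m n {o} o⊥m n<o = n≢0⇒n>0 λ m*n%o≡0 →
  <⇒≱ n<o (∣⇒≤ (coprime-divisor o⊥m (m%n≡0⇒n∣m (m * n) o m*n%o≡0)))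

split-leading-digit : ∀ A N m b .{{_ : NonZero m}} .{{_ : NonZero b}} .{{_ : NonZero (b * m)}} →
                      A * N / (b * m) ≡ (A * (N % m) / m + N / m * A) / b
split-leading-digit A N m b = begin
  A * N / (b * m)                              ≡⟨ /-congʳ (*-comm b m) ⟩
  A * N / (m * b)                              ≡⟨ /-congˡ {o = m * b} (cong (A *_) (m≡m%n+[m/n]*n N m)) ⟩
  A * (N % m + N / m * m) / (m * b)            ≡⟨ /-congˡ {o = m * b} (distribute (N % m) (N / m)) ⟩
  (A * (N % m) + N / m * A * m) / (m * b)      ≡⟨ sym ([m/n+o]/p≡[m+o*n]/[n*p] (A * (N % m)) m (N / m * A) b) ⟩
  (A * (N % m) / m + N / m * A) / b            ∎
  where
  open ≡-Reasoning
  instance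
    m*b≢0 : NonZero (m * b)
    m*b≢0 = m*n≢0 m b
  distribute : ∀ x q → A * (x + q * m) ≡ A * x + q * A * m
  distribute x q = solve (A ∷ x ∷ q ∷ m ∷ [])

module Straddle (c M N Q s : ℕ) .{{_ : NonZero M}} (cM≡s+NQ : suc c * M ≡ s + N * Q)
                (0<s : 0 < s) (s<Q : s < Q) (Q<M : Q < M) where

  Q*N/M≡c : Q * N / M ≡ c
  Q*N/M≡c = quotient-unique c*M≤Q*N Q*N<[1+c]*M
    where
    c*M≤Q*N : c * M ≤ Q * N
    c*M≤Q*N = +-cancelˡ-≤ M (c * M) (Q * N) (begin
      M + c * M  ≡⟨ cM≡s+NQ ⟩
      s + N * Q  ≤⟨ +-monoˡ-≤ (N * Q) (<⇒≤ (<-trans s<Q Q<M)) ⟩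
      M + N * Q  ≡⟨ cong (M +_) (*-comm N Q) ⟩
      M + Q * N  ∎)
      where open ≤-Reasoning
    Q*N<[1+c]*M : Q * N < suc c * M
    Q*N<[1+c]*M = begin-strict
      Q * N      ≡⟨ *-comm Q N ⟩
      N * Q      <⟨ m<n+m (N * Q) 0<s ⟩
      s + N * Q  ≡⟨ cM≡s+NQ ⟨
      suc c * M  ∎
      where open ≤-Reasoning

  Q*[1+N]<[2+c]*M : Q * suc N < suc (suc c) * M
  Q*[1+N]<[2+c]*M = begin-strict
    Q * suc N        ≡⟨ *-suc Q N ⟩
    Q + Q * N        ≡⟨ cong (Q +_) (*-comm Q N) ⟩
    Q + N * Q        ≤⟨ +-monoʳ-≤ Q (m≤n+m (N * Q) s) ⟩
    Q + (s + N * Q)  ≡⟨ cong (Q +_) cM≡s+NQ ⟨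
    Q + suc c * M    <⟨ +-monoˡ-< (suc c * M) Q<M ⟩
    suc (suc c) * M  ∎
    where open ≤-Reasoning

  Q*[1+N]/M≡1+c : Q * suc N / M ≡ suc c
  Q*[1+N]/M≡1+c = quotient-unique [1+c]*M≤Q*[1+N] Q*[1+N]<[2+c]*M
    where
    [1+c]*M≤Q*[1+N] : suc c * M ≤ Q * suc N
    [1+c]*M≤Q*[1+N] = begin
      suc c * M  ≡⟨ cM≡s+NQ ⟩
      s + N * Q  ≤⟨ +-monoˡ-≤ (N * Q) (<⇒≤ s<Q) ⟩
      Q + N * Q  ≡⟨ cong (Q +_) (*-comm N Q) ⟩
      Q + Q * N  ≡⟨ *-suc Q N ⟨
      Q * suc N  ∎
      where open ≤-Reasoning

  1+N<M : .{{_ : NonZero Q}} → suc c < Q → suc N < M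
  1+N<M 1+c<Q = *-cancelˡ-< Q (suc N) M (begin-strict
    Q * suc N        <⟨ Q*[1+N]<[2+c]*M ⟩
    suc (suc c) * M  ≤⟨ *-monoˡ-≤ M 1+c<Q ⟩
    Q * M            ∎)
    where open ≤-Reasoning

  module SameQuotient (P i e : ℕ) .{{_ : NonZero Q}} (P[1+c]≡e+iQ : P * suc c ≡ e + i * Q)
           (0<e : 0 < e) (e<Q : e < Q) (PQ<M : P * Q < M) where

    -- Both bounds on PN below come from this identity: 0 < eM - Ps and eM - Ps + PQ < QM.
    Q*PN+Ps≡Q*iM+eM : Q * (P * N) + P * s ≡ Q * (i * M) + e * M
    Q*PN+Ps≡Q*iM+eM = begin
      Q * (P * N) + P * s  ≡⟨ solve (Q ∷ P ∷ N ∷ s ∷ []) ⟩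
      P * (s + N * Q)      ≡⟨ cong (P *_) cM≡s+NQ ⟨
      P * (suc c * M)      ≡⟨ *-assoc P (suc c) M ⟨
      P * suc c * M        ≡⟨ cong (_* M) P[1+c]≡e+iQ ⟩
      (e + i * Q) * M      ≡⟨ solve (e ∷ i ∷ Q ∷ M ∷ []) ⟩
      Q * (i * M) + e * M  ∎
      where open ≡-Reasoning

    i*M≤P*N : i * M ≤ P * N
    i*M≤P*N = *-cancelˡ-≤ Q (+-cancelʳ-≤ (e * M) (Q * (i * M)) (Q * (P * N)) (begin
      Q * (i * M) + e * M  ≡⟨ Q*PN+Ps≡Q*iM+eM ⟨
      Q * (P * N) + P * s  ≤⟨ +-monoʳ-≤ (Q * (P * N)) P*s≤e*M ⟩
      Q * (P * N) + e * M  ∎))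
      where
      open ≤-Reasoning
      P*s≤e*M : P * s ≤ e * M
      P*s≤e*M = begin
        P * s  ≤⟨ *-monoʳ-≤ P (<⇒≤ s<Q) ⟩
        P * Q  ≤⟨ <⇒≤ PQ<M ⟩
        M      ≤⟨ m≤n*m M e {{>-nonZero 0<e}} ⟩
        e * M  ∎

    P*[1+N]<[1+i]*M : P * suc N < suc i * M
    P*[1+N]<[1+i]*M = *-cancelˡ-< Q (P * suc N) (suc i * M) (+-cancelʳ-< (P * s) _ _ (begin-strict
      Q * (P * suc N) + P * s        ≡⟨ solve (Q ∷ P ∷ N ∷ s ∷ []) ⟩
      Q * (P * N) + P * s + P * Q    ≡⟨ cong (_+ P * Q) Q*PN+Ps≡Q*iM+eM ⟩
      Q * (i * M) + e * M + P * Q    <⟨ +-monoʳ-< (Q * (i * M) + e * M) PQ<M ⟩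
      Q * (i * M) + e * M + M        ≡⟨ solve (Q ∷ i ∷ M ∷ e ∷ []) ⟩
      Q * (i * M) + suc e * M        ≤⟨ +-monoʳ-≤ (Q * (i * M)) (*-monoˡ-≤ M e<Q) ⟩
      Q * (i * M) + Q * M            ≤⟨ m≤m+n (Q * (i * M) + Q * M) (P * s) ⟩
      Q * (i * M) + Q * M + P * s    ≡⟨ solve (Q ∷ i ∷ M ∷ P ∷ s ∷ []) ⟩
      Q * (suc i * M) + P * s        ∎))
      where open ≤-Reasoning

    P*N/M≡i : P * N / M ≡ i
    P*N/M≡i = quotient-unique i*M≤P*N (≤-<-trans (*-monoʳ-≤ P (n≤1+n N)) P*[1+N]<[1+i]*M)

    P*[1+N]/M≡i : P * suc N / M ≡ i
    P*[1+N]/M≡i = quotient-unique (≤-trans i*M≤P*N (*-monoʳ-≤ P (n≤1+n N))) P*[1+N]<[1+i]*M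

module _ (b P Q : ℕ) .{{_ : NonZero b}} where

  module _ (1<b : 1 < b) where

    halving-edge : ∀ {i j} → i < P → j < Q → Edge b P Q (i , j) (i / b , j / b)
    halving-edge {i} {j} i<P j<Q =
      (i<P , j<Q) , 0 , <-trans z<s 1<b , cong (_/ b) (sym (+-identityʳ i)) , cong (_/ b) (sym (+-identityʳ j))

    reaches-origin-within : ∀ n {i j} → i ≤ n → j ≤ n → i < P → j < Q → Reach b P Q (i , j) (0 , 0)
    reaches-origin-within zero    z≤n z≤n _ _ = ε
    reaches-origin-within (suc n) {i} {j} i≤1+n j≤1+n i<P j<Q =
      halving-edge i<P j<Q ◅ reaches-origin-within n (shrink i≤1+n) (shrink j≤1+n)
                               (≤-<-trans (m/n≤m i b) i<P) (≤-<-trans (m/n≤m j b) j<Q)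
      where
      shrink : ∀ {x} → x ≤ suc n → x / b ≤ n
      shrink x≤1+n = ≤-pred (≤-<-trans (/-monoˡ-≤ b x≤1+n) (m/n<m (suc n) b 1<b))

    reaches-origin : ∀ {i j} → i < P → j < Q → Reach b P Q (i , j) (0 , 0)
    reaches-origin {i} {j} = reaches-origin-within (i + j) (m≤m+n i j) (m≤n+m j i)

  module _ .{{_ : NonZero P}} .{{_ : NonZero Q}} where

    origin-reaches-scaled : ∀ k N → N < b ^ k →
      Reach b P Q (0 , 0) (_/_ (P * N) (b ^ k) {{m^n≢0 b k}} , _/_ (Q * N) (b ^ k) {{m^n≢0 b k}})
    origin-reaches-scaled zero    zero    _  rewrite *-zeroʳ P | *-zeroʳ Q = ε
    origin-reaches-scaled zero    (suc N) (s≤s ())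
    origin-reaches-scaled (suc k) N N<b*m = origin-reaches-scaled k (N % m) (m%n<n N m) ◅◅ (digit-edge ◅ ε)
      where
      m : ℕ
      m = b ^ k
      instance
        m≢0 : NonZero m
        m≢0 = m^n≢0 b k
        b*m≢0 : NonZero (b * m)
        b*m≢0 = m^n≢0 b (suc k)
      digit-edge : Edge b P Q (P * (N % m) / m , Q * (N % m) / m) (P * N / (b * m) , Q * N / (b * m))
      digit-edge = (m*n/o<m P (m%n<n N m) , m*n/o<m Q (m%n<n N m)) , N / m , m<n*o⇒m/o<n N<b*m
                 , split-leading-digit P N m b , split-leading-digit Q N m b

    scaled-in-SCC₀ : 1 < b → ∀ k N {i j} → N < b ^ k →
      _/_ (P * N) (b ^ k) {{m^n≢0 b k}} ≡ i → _/_ (Q * N) (b ^ k) {{m^n≢0 b k}} ≡ j → InSCC₀ b P Q (i , j)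
    scaled-in-SCC₀ 1<b k N N<b^k refl refl =
      (i<P , j<Q) , origin-reaches-scaled k N N<b^k , reaches-origin 1<b i<P j<Q
      where
      instance
        b^k≢0 : NonZero (b ^ k)
        b^k≢0 = m^n≢0 b k
      i<P : P * N / b ^ k < P
      i<P = m*n/o<m P N<b^k
      j<Q : Q * N / b ^ k < Q
      j<Q = m*n/o<m Q N<b^k

corollary1 : (b P Q : ℕ) → .{{_ : NonZero b}} → 2 ≤ b → 1 ≤ P → 1 ≤ Q →
    Coprime P Q → Coprime P b → Coprime Q b → b < P → P < Q →
    ∃[ i₀ ] (i₀ < b × InSCC₀ b P Q (i₀ , b ∸ 1) × InSCC₀ b P Q (i₀ , b))
corollary1 b@(suc b′) P Q 1<b 0<P 0<Q P⊥Q _ Q⊥b b<P P<Q =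
    i₀ , m*n/o<n b P<Q
  , scaled-in-SCC₀ b P Q 1<b k N (<-trans (n<1+n N) (1+N<M b<Q)) P*N/M≡i Q*N/M≡c
  , scaled-in-SCC₀ b P Q 1<b k (suc N) (1+N<M b<Q) P*[1+N]/M≡i Q*[1+N]/M≡1+c
  where
  instance
    P≢0 : NonZero P
    P≢0 = >-nonZero 0<P
    Q≢0 : NonZero Q
    Q≢0 = >-nonZero 0<Q
  k M N i₀ : ℕ
  k = P * Q
  M = b ^ k
  instance
    M≢0 : NonZero M
    M≢0 = m^n≢0 b k
  N = b * M / Q
  i₀ = P * b / Q
  b<Q : b < Q
  b<Q = <-trans b<P P<Q
  PQ<M : P * Q < M
  PQ<M = n<b^n b k 1<b
  open Straddle b′ M N Q (b * M % Q) (m≡m%n+[m/n]*n (b * M) Q)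
    (coprime⇒m^n%o>0 b (suc k) Q⊥b (<-trans 1<b b<Q)) (m%n<n (b * M) Q) (≤-<-trans (m≤n*m Q P) PQ<M)
  open SameQuotient P i₀ (P * b % Q) (m≡m%n+[m/n]*n (P * b) Q)
    (coprime⇒m*n%o>0 P b (Coprimality.sym P⊥Q) b<Q) (m%n<n (P * b) Q) PQ<M
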